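{- Let $\gamma\ge1$ and consider a Sparsest Cut instance with vertex set $V_0$, connected capacity graph $(V_0,E_c)$ with positive capacities $\mathrm{cap}_{uv}$, and demand pairs $E_d$ with positive demands $\mathrm{dem}_{uv}$. Build the weighted graph $G=(V,E,w)$: $V=\{u_1,u_2:u\in V_0\}$; for each capacity pair $\{u,v\}\in E_c$ add edges $(u_1,v_2)$ and $(v_1,u_2)$ of weight $\mathrm{cap}_{uv}$; for each demand pair $\{u,v\}\in E_d$ add edges $(u_1,v_1)$ and $(u_2,v_2)$ of weight $\mathrm{dem}_{uv}$; for each $u\in V_0$ add edge $(u_1,u_2)$ of weight $W_\infty$, where $W_\infty$ is any number larger than $\gamma$ times the total weight of all the other edges. Let $S=\{u_1:u\in V_0\}$. If $\phi(A)>\gamma$ for every cut $(A,\bar A)$ of $V_0$, then $G$ is a $\gamma$-stable instance of Max Cut with maximum cut $(S,\bar S)$.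
   Context: Sparsity of a cut $(A,\bar A=V_0\setminus A)$: $\phi(A)=\mathrm{cap}(E_c(A,\bar A))/\mathrm{dem}(E_d(A,\bar A))$, where $E_c(A,\bar A)$ (resp. $E_d(A,\bar A)$) is the set of capacity edges (resp. demand pairs) separated by the cut and $\mathrm{cap}(\cdot)$, $\mathrm{dem}(\cdot)$ denote total capacity/demand; cuts are with $\emptyset\ne A\ne V_0$. A weighted graph $G$ with maximum cut $(S,\bar S)$ is a $\gamma$-stable instance of Max Cut if for every $T\subseteq V$ with $T\neq S$, $T\ne\bar S$: $w(E(S,\bar S)\setminus E(T,\bar T))>\gamma\,w(E(T,\bar T)\setminus E(S,\bar S))$, where $E(X,\bar X)$ is the set of edges crossing the cut and $w(F)$ the total weight of $F$.
   Formalization: The parameter γ, the capacities $\mathrm{cap}_{uv}$, the demands $\mathrm{dem}_{uv}$ and the weight $W_\infty$ take rational values. -}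

module Defs where

open import Data.Nat using (ℕ)
open import Data.Bool using (Bool; true; false; if_then_else_; not)
open import Data.Fin using (Fin; _≟_)
open import Data.List using (List; []; _∷_; _++_; map; allFin)
open import Data.Product using (_×_; _,_; ∃)
open import Data.Rational using (ℚ; 0ℚ; _+_; _*_; _<_; _≤_)
open import Relation.Binary.PropositionalEquality using (_≡_)
open import Relation.Nullary using (¬_; does)

Σl : {A : Set} → List A → (A → ℚ) → ℚ
Σl []       f = 0ℚ
Σl (x ∷ xs) f = f x + Σl xs f

-- Vertices are enumerated by a list `vs` (each vertex exactly once);
-- the weight function w is symmetric, w x y = 0 meaning "no edge".

-- weight of the edges crossing (T, T̄): every crossing unordered edge
-- {x,y} is counted exactly once, as the ordered pair with x ∈ T, y ∉ T.
cutWeight : {V : Set} → List V → (V → V → ℚ) → (V → Bool) → ℚ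
cutWeight vs w T =
  Σl vs λ x → Σl vs λ y →
    if T x then (if T y then 0ℚ else w x y) else 0ℚ

separates : {V : Set} → (V → Bool) → V → V → Bool
separates T x y = if T x then not (T y) else T y

cutDiffWeight : {V : Set} → List V → (V → V → ℚ) → (V → Bool) → (V → Bool) → ℚ
cutDiffWeight vs w S T =
  Σl vs λ x → Σl vs λ y →
    if S x then (if S y then 0ℚ else (if separates T x y then 0ℚ else w x y)) else 0ℚ

SameSet : {V : Set} → (V → Bool) → (V → Bool) → Set
SameSet T S = ∀ x → T x ≡ S x

complement : {V : Set} → (V → Bool) → (V → Bool)
complement S x = not (S x)

IsMaxCut : {V : Set} → List V → (V → V → ℚ) → (V → Bool) → Set
IsMaxCut vs w S = ∀ T → cutWeight vs w T ≤ cutWeight vs w S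

IsStableMaxCut : {V : Set} → List V → (V → V → ℚ) → ℚ → (V → Bool) → Set
IsStableMaxCut vs w γ S =
  IsMaxCut vs w S ×
  (∀ T → ¬ SameSet T S → ¬ SameSet T (complement S) →
     γ * cutDiffWeight vs w T S < cutDiffWeight vs w S T)

-- Capacities and demands are symmetric functions Fin n → Fin n → ℚ,
-- nonnegative, zero on the diagonal; E_c = {uv : cap u v > 0},
-- E_d = {uv : dem u v > 0} (so all capacities/demands of actual
-- edges/pairs are positive).

ValidWeights : (n : ℕ) → (Fin n → Fin n → ℚ) → Set
ValidWeights n c =
  (∀ u v → c u v ≡ c v u) × (∀ u v → 0ℚ ≤ c u v) × (∀ u → c u u ≡ 0ℚ)

data Reach {n : ℕ} (cap : Fin n → Fin n → ℚ) (u : Fin n) : Fin n → Set where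
  here : Reach cap u u
  step : ∀ {v x} → Reach cap u v → 0ℚ < cap v x → Reach cap u x

Connected : (n : ℕ) → (Fin n → Fin n → ℚ) → Set
Connected n cap = ∀ u v → Reach cap u v

-- total capacity / demand of the pairs separated by the cut (A, Ā)
-- (each unordered pair counted once: u ∈ A, v ∉ A)
crossing : (n : ℕ) → (Fin n → Fin n → ℚ) → (Fin n → Bool) → ℚ
crossing n c A =
  Σl (allFin n) λ u → Σl (allFin n) λ v →
    if A u then (if A v then 0ℚ else c u v) else 0ℚ

IsCut : (n : ℕ) → (Fin n → Bool) → Set
IsCut n A = ∃ (λ u → A u ≡ true) × ∃ (λ v → A v ≡ false)

-- φ(A) > γ, i.e. cap(E_c(A,Ā)) / dem(E_d(A,Ā)) > γ, written without
-- division: cap > γ · dem  (for dem = 0 this is φ = +∞ > γ).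
SparsityAbove : (n : ℕ) → (cap dem : Fin n → Fin n → ℚ) → ℚ → (Fin n → Bool) → Set
SparsityAbove n cap dem γ A = γ * crossing n dem A < crossing n cap A

-- The Max Cut instance G.  V = Bool × Fin n, (true , u) = u₁, (false , u) = u₂.

GV : ℕ → Set
GV n = Bool × Fin n

GVerts : (n : ℕ) → List (GV n)
GVerts n = map (true ,_) (allFin n) ++ map (false ,_) (allFin n)

sameSide : Bool → Bool → Bool
sameSide true  b = b
sameSide false b = not b

-- weights: (u₁,v₂),(v₁,u₂) get cap uv; (u₁,v₁),(u₂,v₂) get dem uv;
-- (u₁,u₂) gets W∞; everything else 0.
Gw : (n : ℕ) → (cap dem : Fin n → Fin n → ℚ) → ℚ → GV n → GV n → ℚ
Gw n cap dem W∞ (a , u) (b , v) =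
  if sameSide a b then dem u v
  else (if does (u ≟ v) then W∞ else cap u v)

-- total weight of all edges of G other than the (u₁,u₂) edges:
-- Σ over capacity pairs of 2·cap + Σ over demand pairs of 2·dem,
-- i.e. the sum over ordered pairs (u,v) of cap u v + dem u v.
otherWeight : (n : ℕ) → (cap dem : Fin n → Fin n → ℚ) → ℚ
otherWeight n cap dem =
  Σl (allFin n) λ u → Σl (allFin n) λ v → cap u v + dem u v

Sset : (n : ℕ) → GV n → Bool
Sset n (a , u) = a

-- For symmetric weights and any two vertex sets T and S, the weight of the cut
-- (T, T̄) is the weight of the edges it shares with (S, S̄) plus w(E(T,T̄) ∖ E(S,S̄)),
-- so w(T) − w(S) = w(E(T,T̄) ∖ E(S,S̄)) − w(E(S,S̄) ∖ E(T,T̄)), and γ-stability with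
-- γ ≥ 1 already makes (S, S̄) a maximum cut.  To check stability of G with S = {u₁},
-- take T ∉ {S, S̄}.  If some u₁, u₂ lie on the same side of T, the W∞-edge u₁u₂ is in
-- E(S,S̄) ∖ E(T,T̄), whereas E(T,T̄) ∖ E(S,S̄) consists of demand edges of total weight
-- at most that of all non-W∞ edges.  Otherwise T is determined by A = {u : u₁ ∈ T},
-- which is a cut of V₀: then E(T,T̄) ∖ E(S,S̄) are the demand edges of both copies of
-- (A, Ā), of weight dem(A) + dem(Ā), and E(S,S̄) ∖ E(T,T̄) are the edges u₁v₂ with u, v
-- separated by A, of weight cap(A) + cap(Ā); sparsity of A and Ā concludes.
module Submission where

open import Algebra.Bundles using (CommutativeMonoid)
open import Data.Bool using (Bool; true; false; if_then_else_; not)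
open import Data.Bool.Properties using (¬-not) renaming (_≟_ to _≟ᵇ_)
open import Data.Fin using (Fin; _≟_)
open import Data.Fin.Properties using (any?; ¬∀⟶∃¬)
open import Data.List using (List; []; _∷_; _++_; map; allFin)
open import Data.List.Membership.Propositional using (_∈_)
open import Data.List.Membership.Propositional.Properties using (∈-allFin)
open import Data.List.Relation.Unary.Any using (here; there)
open import Data.Nat using (ℕ)
open import Data.Product using (_,_; map₂)
open import Data.Rational using (ℚ; 0ℚ; 1ℚ; _+_; _*_; _<_; _≤_; nonNegative)
open import Data.Rational.Properties hiding (_≟_)
open import Function using (_∘_)
open import Relation.Binary.PropositionalEquality
open import Relation.Nullary using (¬_; yes; no; does; contradiction)
open import Relation.Nullary.Decidable using (dec-true; dec-false)

open import Algebra.Properties.CommutativeSemigroup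
  (CommutativeMonoid.commutativeSemigroup +-0-commutativeMonoid) using (interchange)

open import Defs

p≤p+q : ∀ {p q} → 0ℚ ≤ q → p ≤ p + q
p≤p+q {p} {q} 0≤q = subst (_≤ p + q) (+-identityʳ p) (+-monoʳ-≤ p 0≤q)

p≤q+p : ∀ {p q} → 0ℚ ≤ q → p ≤ q + p
p≤q+p {p} {q} 0≤q = subst (_≤ q + p) (+-identityˡ p) (+-monoˡ-≤ p 0≤q)

p≤q*p : ∀ {p q} → 1ℚ ≤ q → 0ℚ ≤ p → p ≤ q * p
p≤q*p {p} {q} 1≤q 0≤p = subst (_≤ q * p) (*-identityˡ p) (*-monoʳ-≤-nonNeg p {{nonNegative 0≤p}} 1≤q)

p+p≤q+q⇒p≤q : ∀ {p q} → p + p ≤ q + q → p ≤ q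
p+p≤q+q⇒p≤q p+p≤q+q = ≮⇒≥ λ q<p → <-irrefl refl (≤-<-trans p+p≤q+q (+-mono-< q<p q<p))

Σl-cong : ∀ {A : Set} (xs : List A) {f g : A → ℚ} → (∀ x → f x ≡ g x) → Σl xs f ≡ Σl xs g
Σl-cong []       f≡g = refl
Σl-cong (x ∷ xs) f≡g = cong₂ _+_ (f≡g x) (Σl-cong xs f≡g)

Σl-zero : ∀ {A : Set} (xs : List A) → Σl xs (λ _ → 0ℚ) ≡ 0ℚ
Σl-zero []       = refl
Σl-zero (x ∷ xs) = trans (+-identityˡ _) (Σl-zero xs)

Σl-+ : ∀ {A : Set} (xs : List A) (f g : A → ℚ) → Σl xs (λ x → f x + g x) ≡ Σl xs f + Σl xs g
Σl-+ []       f g = refl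
Σl-+ (x ∷ xs) f g = trans (cong (f x + g x +_) (Σl-+ xs f g)) (interchange (f x) (g x) _ _)

Σl-mono : ∀ {A : Set} (xs : List A) {f g : A → ℚ} → (∀ x → f x ≤ g x) → Σl xs f ≤ Σl xs g
Σl-mono []       f≤g = ≤-refl
Σl-mono (x ∷ xs) f≤g = +-mono-≤ (f≤g x) (Σl-mono xs f≤g)

Σl-nonneg : ∀ {A : Set} (xs : List A) {f : A → ℚ} → (∀ x → 0ℚ ≤ f x) → 0ℚ ≤ Σl xs f
Σl-nonneg xs 0≤f = subst (_≤ Σl xs _) (Σl-zero xs) (Σl-mono xs 0≤f)

term≤Σl : ∀ {A : Set} {xs : List A} {x : A} (f : A → ℚ) → (∀ y → 0ℚ ≤ f y) → x ∈ xs → f x ≤ Σl xs f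
term≤Σl {xs = y ∷ ys} f 0≤f (here refl)  = p≤p+q (Σl-nonneg ys 0≤f)
term≤Σl {xs = y ∷ ys} f 0≤f (there x∈ys) = ≤-trans (term≤Σl f 0≤f x∈ys) (p≤q+p (0≤f y))

Σl-++ : ∀ {A : Set} (xs ys : List A) (f : A → ℚ) → Σl (xs ++ ys) f ≡ Σl xs f + Σl ys f
Σl-++ []       ys f = sym (+-identityˡ _)
Σl-++ (x ∷ xs) ys f = trans (cong (f x +_) (Σl-++ xs ys f)) (sym (+-assoc (f x) _ _))

Σl-map : ∀ {A B : Set} (g : A → B) (xs : List A) (f : B → ℚ) → Σl (map g xs) f ≡ Σl xs (f ∘ g)
Σl-map g []       f = refl
Σl-map g (x ∷ xs) f = cong (f (g x) +_) (Σl-map g xs f)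

Σl-swap : ∀ {A B : Set} (xs : List A) (ys : List B) (f : A → B → ℚ) →
          Σl xs (λ x → Σl ys (f x)) ≡ Σl ys (λ y → Σl xs (λ x → f x y))
Σl-swap []       ys f = sym (Σl-zero ys)
Σl-swap (x ∷ xs) ys f =
  trans (cong (Σl ys (f x) +_) (Σl-swap xs ys f)) (sym (Σl-+ ys (f x) _))

Σ² : {A : Set} → List A → (A → A → ℚ) → ℚ
Σ² xs f = Σl xs λ x → Σl xs (f x)

Σ²-cong : ∀ {A : Set} (xs : List A) {f g : A → A → ℚ} →
          (∀ x y → f x y ≡ g x y) → Σ² xs f ≡ Σ² xs g
Σ²-cong xs f≡g = Σl-cong xs (λ x → Σl-cong xs (f≡g x))

Σ²-zero : ∀ {A : Set} (xs : List A) → Σ² xs (λ _ _ → 0ℚ) ≡ 0ℚ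
Σ²-zero xs = trans (Σl-cong xs (λ _ → Σl-zero xs)) (Σl-zero xs)

Σ²-+ : ∀ {A : Set} (xs : List A) (f g : A → A → ℚ) →
       Σ² xs (λ x y → f x y + g x y) ≡ Σ² xs f + Σ² xs g
Σ²-+ xs f g = trans (Σl-cong xs (λ x → Σl-+ xs (f x) (g x))) (Σl-+ xs _ _)

Σ²-mono : ∀ {A : Set} (xs : List A) {f g : A → A → ℚ} →
          (∀ x y → f x y ≤ g x y) → Σ² xs f ≤ Σ² xs g
Σ²-mono xs f≤g = Σl-mono xs (λ x → Σl-mono xs (f≤g x))

Σ²-nonneg : ∀ {A : Set} (xs : List A) {f : A → A → ℚ} → (∀ x y → 0ℚ ≤ f x y) → 0ℚ ≤ Σ² xs f
Σ²-nonneg xs 0≤f = Σl-nonneg xs (λ x → Σl-nonneg xs (0≤f x))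

Σ²-swap : ∀ {A : Set} (xs : List A) (f : A → A → ℚ) → Σ² xs f ≡ Σ² xs (λ x y → f y x)
Σ²-swap xs f = Σl-swap xs xs f

term≤Σ² : ∀ {A : Set} {xs : List A} {x y : A} (f : A → A → ℚ) →
          (∀ x y → 0ℚ ≤ f x y) → x ∈ xs → y ∈ xs → f x y ≤ Σ² xs f
term≤Σ² {xs = xs} f 0≤f x∈xs y∈xs =
  ≤-trans (term≤Σl (f _) (0≤f _) y∈xs) (term≤Σl (λ x → Σl xs (f x)) (λ x → Σl-nonneg xs (0≤f x)) x∈xs)

-- `separates T x y` unfolds to `differ (T x) (T y)`, and the summands of `cutWeight`,
-- `cutDiffWeight` and `crossing` are `crossTerm`s.
differ : Bool → Bool → Bool
differ a b = if a then not b else b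

crossTerm : Bool → Bool → ℚ → ℚ
crossTerm a b q = if a then (if b then 0ℚ else q) else 0ℚ

differ-not : ∀ a b → differ (not a) (not b) ≡ differ a b
differ-not true  true  = refl
differ-not true  false = refl
differ-not false true  = refl
differ-not false false = refl

unless-nonneg : ∀ b {q} → 0ℚ ≤ q → 0ℚ ≤ (if b then 0ℚ else q)
unless-nonneg true  0≤q = ≤-refl
unless-nonneg false 0≤q = 0≤q

unless-differ-refl : ∀ {a b} q → a ≡ b → (if differ a b then 0ℚ else q) ≡ q
unless-differ-refl {true}  q refl = refl
unless-differ-refl {false} q refl = refl

crossTerm-0 : ∀ a b → crossTerm a b 0ℚ ≡ 0ℚ
crossTerm-0 true  true  = refl
crossTerm-0 true  false = refl
crossTerm-0 false b     = refl

crossTerm-nonneg : ∀ a b {q} → 0ℚ ≤ q → 0ℚ ≤ crossTerm a b q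
crossTerm-nonneg true  true  0≤q = ≤-refl
crossTerm-nonneg true  false 0≤q = 0≤q
crossTerm-nonneg false b     0≤q = ≤-refl

crossTerm-comm : ∀ a b c d q → crossTerm a b (crossTerm c d q) ≡ crossTerm c d (crossTerm a b q)
crossTerm-comm true  true  c d q = sym (crossTerm-0 c d)
crossTerm-comm true  false c d q = refl
crossTerm-comm false b     c d q = sym (crossTerm-0 c d)

crossTerm-split : ∀ a b s q →
                  crossTerm a b q ≡ crossTerm a b (if s then q else 0ℚ) + crossTerm a b (if s then 0ℚ else q)
crossTerm-split true  true  s     q = refl
crossTerm-split true  false true  q = sym (+-identityʳ q)
crossTerm-split true  false false q = sym (+-identityˡ q)
crossTerm-split false b     s     q = refl

crossTerm-differ : ∀ a b c d q →
                   crossTerm a b (if differ c d then q else 0ℚ)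
                   ≡ crossTerm a b (crossTerm c d q) + crossTerm a b (crossTerm d c q)
crossTerm-differ true  false true  true  q = refl
crossTerm-differ true  false true  false q = sym (+-identityʳ q)
crossTerm-differ true  false false true  q = sym (+-identityˡ q)
crossTerm-differ true  false false false q = refl
crossTerm-differ true  true  c     d     q = refl
crossTerm-differ false b     c     d     q = refl

crossTerm-unseparated : ∀ a b {c} q → differ a b ≡ c → crossTerm a b (if c then 0ℚ else q) ≡ 0ℚ
crossTerm-unseparated true  true  q _    = refl
crossTerm-unseparated true  false q refl = refl
crossTerm-unseparated false b     q _    = refl

crossTerm-+-swap-≤ : ∀ a b {q} → 0ℚ ≤ q → crossTerm a b q + crossTerm b a q ≤ q
crossTerm-+-swap-≤ true  true  0≤q = 0≤q
crossTerm-+-swap-≤ true  false 0≤q = ≤-reflexive (+-identityʳ _)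
crossTerm-+-swap-≤ false true  0≤q = ≤-reflexive (+-identityˡ _)
crossTerm-+-swap-≤ false false 0≤q = 0≤q

-- p matters only when a ≠ b, as then b' = not b = a.
unless-differ-not : ∀ a b {b'} p q → b' ≡ not b → (¬ a ≡ b → p ≡ q) →
                    (if differ a b' then 0ℚ else p) ≡ crossTerm a b q + crossTerm (not a) (not b) q
unless-differ-not true  true  p q refl p≡q = refl
unless-differ-not true  false p q refl p≡q = trans (p≡q λ ()) (sym (+-identityʳ q))
unless-differ-not false true  p q refl p≡q = trans (p≡q λ ()) (sym (+-identityˡ q))
unless-differ-not false false p q refl p≡q = refl

module _ {V : Set} (vs : List V) (w : V → V → ℚ) where

  crossBoth : (V → Bool) → (V → Bool) → ℚ
  crossBoth T S = Σ² vs λ x y → crossTerm (T x) (T y) (if separates S x y then w x y else 0ℚ)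

  cutWeight-split : ∀ T S → cutWeight vs w T ≡ crossBoth T S + cutDiffWeight vs w T S
  cutWeight-split T S =
    trans (Σ²-cong vs λ x y → crossTerm-split (T x) (T y) (separates S x y) (w x y)) (Σ²-+ vs _ _)

  crossBoth-sym : (∀ x y → w x y ≡ w y x) → ∀ T S → crossBoth T S ≡ crossBoth S T
  crossBoth-sym w-sym T S = begin
      crossBoth T S
    ≡⟨ Σ²-cong vs (λ x y → crossTerm-differ (T x) (T y) (S x) (S y) (w x y)) ⟩
      Σ² vs (λ x y → crossTerm (T x) (T y) (crossTerm (S x) (S y) (w x y))
                     + crossTerm (T x) (T y) (crossTerm (S y) (S x) (w x y)))
    ≡⟨ Σ²-+ vs _ _ ⟩
      Σ² vs (λ x y → crossTerm (T x) (T y) (crossTerm (S x) (S y) (w x y)))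
      + Σ² vs (λ x y → crossTerm (T x) (T y) (crossTerm (S y) (S x) (w x y)))
    ≡⟨ cong₂ _+_ (Σ²-cong vs λ x y → crossTerm-comm (T x) (T y) (S x) (S y) (w x y))
                 (trans (Σ²-swap vs _) (Σ²-cong vs λ x y →
                   trans (crossTerm-comm (T y) (T x) (S x) (S y) (w y x))
                         (cong (crossTerm (S x) (S y) ∘ crossTerm (T y) (T x)) (w-sym y x)))) ⟩
      Σ² vs (λ x y → crossTerm (S x) (S y) (crossTerm (T x) (T y) (w x y)))
      + Σ² vs (λ x y → crossTerm (S x) (S y) (crossTerm (T y) (T x) (w x y)))
    ≡⟨ Σ²-+ vs _ _ ⟨
      Σ² vs (λ x y → crossTerm (S x) (S y) (crossTerm (T x) (T y) (w x y))
                     + crossTerm (S x) (S y) (crossTerm (T y) (T x) (w x y)))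
    ≡⟨ Σ²-cong vs (λ x y → crossTerm-differ (S x) (S y) (T x) (T y) (w x y)) ⟨
      crossBoth S T ∎
    where open ≡-Reasoning

  cutDiffWeight-≤⇒cutWeight-≤ : (∀ x y → w x y ≡ w y x) → ∀ T S →
    cutDiffWeight vs w T S ≤ cutDiffWeight vs w S T → cutWeight vs w T ≤ cutWeight vs w S
  cutDiffWeight-≤⇒cutWeight-≤ w-sym T S diff≤ = begin
    cutWeight vs w T                           ≡⟨ cutWeight-split T S ⟩
    crossBoth T S + cutDiffWeight vs w T S     ≤⟨ +-monoʳ-≤ (crossBoth T S) diff≤ ⟩
    crossBoth T S + cutDiffWeight vs w S T     ≡⟨ cong (_+ cutDiffWeight vs w S T) (crossBoth-sym w-sym T S) ⟩
    crossBoth S T + cutDiffWeight vs w S T     ≡⟨ cutWeight-split S T ⟨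
    cutWeight vs w S                           ∎
    where open ≤-Reasoning

  cutDiffWeight-nonneg : (∀ x y → 0ℚ ≤ w x y) → ∀ S T → 0ℚ ≤ cutDiffWeight vs w S T
  cutDiffWeight-nonneg w-nonneg S T =
    Σ²-nonneg vs λ x y → crossTerm-nonneg (S x) (S y) (unless-nonneg (separates T x y) (w-nonneg x y))

  cutDiffWeight-≡0 : ∀ T S → (∀ x y → separates T x y ≡ separates S x y) → cutDiffWeight vs w T S ≡ 0ℚ
  cutDiffWeight-≡0 T S same =
    trans (Σ²-cong vs λ x y → crossTerm-unseparated (T x) (T y) (w x y) (same x y)) (Σ²-zero vs)

  Stable : ℚ → (V → Bool) → Set
  Stable γ S = ∀ T → ¬ SameSet T S → ¬ SameSet T (complement S) →
               γ * cutDiffWeight vs w T S < cutDiffWeight vs w S T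

  stable⇒cutDiffWeight-≤ : (∀ x y → 0ℚ ≤ w x y) → ∀ {γ} → 1ℚ ≤ γ → ∀ S → Stable γ S →
                           ∀ T → cutDiffWeight vs w T S ≤ cutDiffWeight vs w S T
  stable⇒cutDiffWeight-≤ w-nonneg 1≤γ S stable T with cutDiffWeight vs w T S ≤? cutDiffWeight vs w S T
  ... | yes diff≤ = diff≤
  ... | no diff≰ = contradiction (≤-trans (p≤q*p 1≤γ (cutDiffWeight-nonneg w-nonneg T S))
                                          (<⇒≤ (stable T T≢S T≢S̄))) diff≰
    where
    unseparated-≤ : (∀ x y → separates T x y ≡ separates S x y) →
                    cutDiffWeight vs w T S ≤ cutDiffWeight vs w S T
    unseparated-≤ same = subst (_≤ cutDiffWeight vs w S T) (sym (cutDiffWeight-≡0 T S same)) (cutDiffWeight-nonneg w-nonneg S T)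

    T≢S : ¬ SameSet T S
    T≢S T≡S = diff≰ (unseparated-≤ λ x y → cong₂ differ (T≡S x) (T≡S y))

    T≢S̄ : ¬ SameSet T (complement S)
    T≢S̄ T≡S̄ = diff≰ (unseparated-≤ λ x y → trans (cong₂ differ (T≡S̄ x) (T≡S̄ y)) (differ-not (S x) (S y)))

  stable⇒stableMaxCut : (∀ x y → w x y ≡ w y x) → (∀ x y → 0ℚ ≤ w x y) →
                        ∀ {γ} → 1ℚ ≤ γ → ∀ S → Stable γ S → IsStableMaxCut vs w γ S
  stable⇒stableMaxCut w-sym w-nonneg 1≤γ S stable =
    (λ T → cutDiffWeight-≤⇒cutWeight-≤ w-sym T S (stable⇒cutDiffWeight-≤ w-nonneg 1≤γ S stable T)) , stable

crossing-cong : ∀ {n} (c : Fin n → Fin n → ℚ) {A B : Fin n → Bool} →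
                (∀ u → A u ≡ B u) → crossing n c A ≡ crossing n c B
crossing-cong {n} c A≡B = Σ²-cong (allFin n) λ u v → cong₂ (λ a b → crossTerm a b (c u v)) (A≡B u) (A≡B v)

crossing-+-crossing-≤ : ∀ {n} (c : Fin n → Fin n → ℚ) → (∀ u v → c u v ≡ c v u) →
                        (∀ u v → 0ℚ ≤ c u v) → ∀ A → crossing n c A + crossing n c A ≤ Σ² (allFin n) c
crossing-+-crossing-≤ {n} c c-sym c-nonneg A = begin
    crossing n c A + crossing n c A
  ≡⟨ cong (crossing n c A +_) (trans (Σ²-swap (allFin n) _) (Σ²-cong (allFin n) λ u v →
       cong (crossTerm (A v) (A u)) (c-sym v u))) ⟩
    crossing n c A + Σ² (allFin n) (λ u v → crossTerm (A v) (A u) (c u v))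
  ≡⟨ Σ²-+ (allFin n) _ _ ⟨
    Σ² (allFin n) (λ u v → crossTerm (A u) (A v) (c u v) + crossTerm (A v) (A u) (c u v))
  ≤⟨ Σ²-mono (allFin n) (λ u v → crossTerm-+-swap-≤ (A u) (A v) (c-nonneg u v)) ⟩
    Σ² (allFin n) c ∎
  where open ≤-Reasoning

nonconstant⇒IsCut : ∀ {n} (A : Fin n → Bool) →
                    ¬ (∀ u → A u ≡ false) → ¬ (∀ u → A u ≡ true) → IsCut n A
nonconstant⇒IsCut {n} A ¬false ¬true =
  map₂ ¬-not (¬∀⟶∃¬ n _ (λ u → A u ≟ᵇ false) ¬false) , map₂ ¬-not (¬∀⟶∃¬ n _ (λ u → A u ≟ᵇ true) ¬true)

IsCut-complement : ∀ {n} {A : Fin n → Bool} → IsCut n A → IsCut n (complement A)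
IsCut-complement ((u , Au) , (v , Av)) = (v , cong not Av) , (u , cong not Au)

module Reduction (n : ℕ) (cap dem : Fin n → Fin n → ℚ) (W∞ : ℚ)
                (cap-sym : ∀ u v → cap u v ≡ cap v u) (cap-nonneg : ∀ u v → 0ℚ ≤ cap u v)
                (dem-sym : ∀ u v → dem u v ≡ dem v u) (dem-nonneg : ∀ u v → 0ℚ ≤ dem u v)
                (W∞-nonneg : 0ℚ ≤ W∞) where

  w : GV n → GV n → ℚ
  w = Gw n cap dem W∞

  link : Fin n → Fin n → ℚ
  link u v = w (true , u) (false , v)

  link-off-diagonal : ∀ {u v} → ¬ u ≡ v → link u v ≡ cap u v
  link-off-diagonal {u} {v} u≢v = cong (λ b → if b then W∞ else cap u v) (dec-false (u ≟ v) u≢v)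

  link-diagonal : ∀ u → link u u ≡ W∞
  link-diagonal u = cong (λ b → if b then W∞ else cap u u) (dec-true (u ≟ u) refl)

  link-sym : ∀ u v → link u v ≡ link v u
  link-sym u v with u ≟ v
  ... | yes refl = sym (link-diagonal u)
  ... | no u≢v = trans (cap-sym u v) (sym (link-off-diagonal (u≢v ∘ sym)))

  w-sym : ∀ x y → w x y ≡ w y x
  w-sym (true  , u) (true  , v) = dem-sym u v
  w-sym (true  , u) (false , v) = link-sym u v
  w-sym (false , u) (true  , v) = link-sym u v
  w-sym (false , u) (false , v) = dem-sym u v

  w-nonneg : ∀ x y → 0ℚ ≤ w x y
  w-nonneg (a , u) (b , v) with sameSide a b | does (u ≟ v)
  ... | true  | _     = dem-nonneg u v
  ... | false | true  = W∞-nonneg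
  ... | false | false = cap-nonneg u v

  Σl-GVerts : (f : GV n → ℚ) →
              Σl (GVerts n) f ≡ Σl (allFin n) (λ u → f (true , u)) + Σl (allFin n) (λ u → f (false , u))
  Σl-GVerts f = trans (Σl-++ (map (true ,_) (allFin n)) _ f)
                      (cong₂ _+_ (Σl-map _ (allFin n) f) (Σl-map _ (allFin n) f))

  Σ²-GVerts : (F : GV n → GV n → ℚ) → Σ² (GVerts n) F ≡
    (Σ² (allFin n) (λ u v → F (true , u) (true , v)) + Σ² (allFin n) (λ u v → F (true , u) (false , v)))
    + (Σ² (allFin n) (λ u v → F (false , u) (true , v)) + Σ² (allFin n) (λ u v → F (false , u) (false , v)))
  Σ²-GVerts F = trans (Σl-cong (GVerts n) (λ x → Σl-GVerts (F x)))
                      (trans (Σl-GVerts _) (cong₂ _+_ (Σl-+ (allFin n) _ _) (Σl-+ (allFin n) _ _)))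

  cutDiffWeight-T-Sset : ∀ T → cutDiffWeight (GVerts n) w T (Sset n)
                         ≡ crossing n dem (λ u → T (true , u)) + crossing n dem (λ u → T (false , u))
  cutDiffWeight-T-Sset T = begin
      cutDiffWeight (GVerts n) w T (Sset n)
    ≡⟨ Σ²-GVerts _ ⟩
      (crossing n dem A₁ + cross-layers true false) + (cross-layers false true + crossing n dem A₂)
    ≡⟨ cong₂ _+_ (trans (cong (crossing n dem A₁ +_) (cross-layers≡0 true false)) (+-identityʳ (crossing n dem A₁)))
                 (trans (cong (_+ crossing n dem A₂) (cross-layers≡0 false true)) (+-identityˡ (crossing n dem A₂))) ⟩
      crossing n dem A₁ + crossing n dem A₂ ∎
    where
    open ≡-Reasoning
    A₁ A₂ : Fin n → Bool
    A₁ u = T (true , u)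
    A₂ u = T (false , u)
    cross-layers : Bool → Bool → ℚ
    cross-layers a b = Σ² (allFin n) (λ u v → crossTerm (T (a , u)) (T (b , v)) 0ℚ)
    cross-layers≡0 : ∀ a b → cross-layers a b ≡ 0ℚ
    cross-layers≡0 a b = trans (Σ²-cong (allFin n) λ u v → crossTerm-0 (T (a , u)) (T (b , v))) (Σ²-zero (allFin n))

  cutDiffWeight-Sset-T : ∀ T → cutDiffWeight (GVerts n) w (Sset n) T
                         ≡ Σ² (allFin n) (λ u v → if separates T (true , u) (false , v) then 0ℚ else link u v)
  cutDiffWeight-Sset-T T = begin
      cutDiffWeight (GVerts n) w (Sset n) T
    ≡⟨ Σ²-GVerts _ ⟩
      (Σ² (allFin n) (λ _ _ → 0ℚ) + kept) + (Σ² (allFin n) (λ _ _ → 0ℚ) + Σ² (allFin n) (λ _ _ → 0ℚ))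
    ≡⟨ cong₂ _+_ (cong (_+ kept) (Σ²-zero (allFin n))) (cong₂ _+_ (Σ²-zero (allFin n)) (Σ²-zero (allFin n))) ⟩
      (0ℚ + kept) + 0ℚ
    ≡⟨ trans (+-identityʳ _) (+-identityˡ kept) ⟩
      kept ∎
    where
    open ≡-Reasoning
    kept : ℚ
    kept = Σ² (allFin n) (λ u v → if separates T (true , u) (false , v) then 0ℚ else link u v)

  cutDiffWeight-T-Sset≤otherWeight : ∀ T → cutDiffWeight (GVerts n) w T (Sset n) ≤ otherWeight n cap dem
  cutDiffWeight-T-Sset≤otherWeight T = p+p≤q+q⇒p≤q (begin
      cutDiffWeight (GVerts n) w T (Sset n) + cutDiffWeight (GVerts n) w T (Sset n)
    ≡⟨ cong₂ _+_ (cutDiffWeight-T-Sset T) (cutDiffWeight-T-Sset T) ⟩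
      (crossing n dem A₁ + crossing n dem A₂) + (crossing n dem A₁ + crossing n dem A₂)
    ≡⟨ interchange (crossing n dem A₁) (crossing n dem A₂) _ _ ⟩
      (crossing n dem A₁ + crossing n dem A₁) + (crossing n dem A₂ + crossing n dem A₂)
    ≤⟨ +-mono-≤ (crossing-+-crossing-≤ dem dem-sym dem-nonneg A₁)
                (crossing-+-crossing-≤ dem dem-sym dem-nonneg A₂) ⟩
      Σ² (allFin n) dem + Σ² (allFin n) dem
    ≤⟨ +-mono-≤ dem≤other dem≤other ⟩
      otherWeight n cap dem + otherWeight n cap dem ∎)
    where
    open ≤-Reasoning
    A₁ A₂ : Fin n → Bool
    A₁ u = T (true , u)
    A₂ u = T (false , u)
    dem≤other : Σ² (allFin n) dem ≤ otherWeight n cap dem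
    dem≤other = Σ²-mono (allFin n) λ u v → p≤q+p (cap-nonneg u v)

  W∞≤cutDiffWeight-Sset-T : ∀ T u → T (true , u) ≡ T (false , u) → W∞ ≤ cutDiffWeight (GVerts n) w (Sset n) T
  W∞≤cutDiffWeight-Sset-T T u glued = begin
    W∞                                     ≡⟨ trans (unless-differ-refl (link u u) glued) (link-diagonal u) ⟨
    kept u u                               ≤⟨ term≤Σ² kept kept-nonneg (∈-allFin u) (∈-allFin u) ⟩
    Σ² (allFin n) kept                     ≡⟨ cutDiffWeight-Sset-T T ⟨
    cutDiffWeight (GVerts n) w (Sset n) T  ∎
    where
    open ≤-Reasoning
    kept : Fin n → Fin n → ℚ
    kept u v = if separates T (true , u) (false , v) then 0ℚ else link u v
    kept-nonneg : ∀ u v → 0ℚ ≤ kept u v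
    kept-nonneg u v = unless-nonneg (separates T (true , u) (false , v)) (w-nonneg (true , u) (false , v))

  glued-stable : ∀ {γ} → 0ℚ ≤ γ → γ * otherWeight n cap dem < W∞ → ∀ T u → T (true , u) ≡ T (false , u) →
                 γ * cutDiffWeight (GVerts n) w T (Sset n) < cutDiffWeight (GVerts n) w (Sset n) T
  glued-stable {γ} 0≤γ γO<W∞ T u glued = begin-strict
    γ * cutDiffWeight (GVerts n) w T (Sset n)
      ≤⟨ *-monoˡ-≤-nonNeg γ {{nonNegative 0≤γ}} (cutDiffWeight-T-Sset≤otherWeight T) ⟩
    γ * otherWeight n cap dem              <⟨ γO<W∞ ⟩
    W∞                                     ≤⟨ W∞≤cutDiffWeight-Sset-T T u glued ⟩
    cutDiffWeight (GVerts n) w (Sset n) T  ∎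
    where open ≤-Reasoning

  split-stable : ∀ {γ} → (∀ A → IsCut n A → SparsityAbove n cap dem γ A) →
                 ∀ T → (∀ u → T (false , u) ≡ not (T (true , u))) →
                 ¬ SameSet T (Sset n) → ¬ SameSet T (complement (Sset n)) →
                 γ * cutDiffWeight (GVerts n) w T (Sset n) < cutDiffWeight (GVerts n) w (Sset n) T
  split-stable {γ} sparse T split T≢S T≢S̄ = begin-strict
    γ * cutDiffWeight (GVerts n) w T (Sset n)       ≡⟨ cong (γ *_) T-S-split ⟩
    γ * (crossing n dem A + crossing n dem Ā)       ≡⟨ *-distribˡ-+ γ _ _ ⟩
    γ * crossing n dem A + γ * crossing n dem Ā     <⟨ +-mono-< (sparse A A-cut) (sparse Ā (IsCut-complement A-cut)) ⟩
    crossing n cap A + crossing n cap Ā             ≡⟨ S-T-split ⟨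
    cutDiffWeight (GVerts n) w (Sset n) T           ∎
    where
    open ≤-Reasoning
    A Ā : Fin n → Bool
    A u = T (true , u)
    Ā = complement A

    A-cut : IsCut n A
    A-cut = nonconstant⇒IsCut A
      (λ A≡false → T≢S̄ λ { (true , u) → A≡false u ; (false , u) → trans (split u) (cong not (A≡false u)) })
      (λ A≡true  → T≢S  λ { (true , u) → A≡true u  ; (false , u) → trans (split u) (cong not (A≡true u)) })

    T-S-split : cutDiffWeight (GVerts n) w T (Sset n) ≡ crossing n dem A + crossing n dem Ā
    T-S-split = trans (cutDiffWeight-T-Sset T) (cong (crossing n dem A +_) (crossing-cong dem split))

    S-T-split : cutDiffWeight (GVerts n) w (Sset n) T ≡ crossing n cap A + crossing n cap Ā
    S-T-split = trans (cutDiffWeight-Sset-T T) (trans (Σ²-cong (allFin n) λ u v →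
                  unless-differ-not (A u) (A v) (link u v) (cap u v) (split v)
                    (λ Au≢Av → link-off-diagonal (λ u≡v → Au≢Av (cong A u≡v))))
                  (Σ²-+ (allFin n) _ _))

lemma2 : (γ : ℚ) → 1ℚ ≤ γ →
         (n : ℕ) (cap dem : Fin n → Fin n → ℚ) →
         ValidWeights n cap → ValidWeights n dem →
         Connected n cap →
         (W∞ : ℚ) → γ * otherWeight n cap dem < W∞ →
         (∀ (A : Fin n → Bool) → IsCut n A → SparsityAbove n cap dem γ A) →
         IsStableMaxCut (GVerts n) (Gw n cap dem W∞) γ (Sset n)
lemma2 γ 1≤γ n cap dem (cap-sym , cap-nonneg , _) (dem-sym , dem-nonneg , _) _ W∞ γO<W∞ sparse =
  stable⇒stableMaxCut (GVerts n) w w-sym w-nonneg 1≤γ (Sset n) stable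
  where
  0≤γ : 0ℚ ≤ γ
  0≤γ = ≤-trans (nonNegative⁻¹ 1ℚ) 1≤γ

  0≤γO : 0ℚ ≤ γ * otherWeight n cap dem
  0≤γO = subst (_≤ γ * otherWeight n cap dem) (*-zeroʳ γ) (*-monoˡ-≤-nonNeg γ {{nonNegative 0≤γ}}
           (Σ²-nonneg (allFin n) λ u v → +-mono-≤ (cap-nonneg u v) (dem-nonneg u v)))

  open Reduction n cap dem W∞ cap-sym cap-nonneg dem-sym dem-nonneg (<⇒≤ (≤-<-trans 0≤γO γO<W∞))

  stable : Stable (GVerts n) w γ (Sset n)
  stable T T≢S T≢S̄ with any? (λ u → T (true , u) ≟ᵇ T (false , u))
  ... | yes (u , glued) = glued-stable {γ} 0≤γ γO<W∞ T u glued
  ... | no ¬glued = split-stable {γ} sparse T (λ u → ¬-not (λ e → ¬glued (u , sym e))) T≢S T≢S̄
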